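{- $ST(2)\ge 6$.
   Context: For $c\ge 3$, a $c$-partite tournament is an orientation of a complete $c$-partite graph; it is $r$-balanced if every partite set has exactly $r$ vertices, and regular if every vertex has in-degree equal to out-degree. A partition into maximal tournaments of an $r$-balanced $c$-partite tournament is a set of $r$ pairwise vertex-disjoint tournaments of order $c$ covering all vertices; it is a strong partition if each of these tournaments is strongly connected. $ST(r)$ is the minimum integer $c'$ such that every regular $r$-balanced $c$-partite tournament with $c\ge c'$ has a strong partition. -}

module Defs where

open import Data.Nat using (ℕ; zero; suc; _+_; _≤_)
open import Data.Fin using (Fin)
open import Data.Bool using (Bool; true; false; not)
open import Data.Product using (_×_; _,_; proj₁; proj₂; Σ; ∃)
open import Data.List using (List; length; filter; allFin; cartesianProduct)
open import Relation.Binary.PropositionalEquality using (_≡_; _≢_)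
open import Relation.Nullary using (¬_)
open import Function.Definitions using (Injective)
import Data.Bool.Properties as BP

-- Vertices of an r-balanced c-partite tournament: vertex (i , j) is the
-- j-th vertex of the i-th partite set.
Vertex : ℕ → ℕ → Set
Vertex c r = Fin c × Fin r

partOf : ∀ {c r} → Vertex c r → Fin c
partOf = proj₁

vertices : (c r : ℕ) → List (Vertex c r)
vertices c r = cartesianProduct (allFin c) (allFin r)

-- An r-balanced c-partite tournament: an orientation of the complete
-- c-partite graph with parts of size r. arc u v ≡ true means u → v.
record BalancedMultipartiteTournament (c r : ℕ) : Set where
  field
    arc : Vertex c r → Vertex c r → Bool
    noArcInPart : ∀ u v → partOf u ≡ partOf v → arc u v ≡ false
    orient : ∀ u v → partOf u ≢ partOf v → arc u v ≡ not (arc v u)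

open BalancedMultipartiteTournament public

outDeg : ∀ {c r} → BalancedMultipartiteTournament c r → Vertex c r → ℕ
outDeg {c} {r} T u = length (filter (λ v → arc T u v BP.≟ true) (vertices c r))

inDeg : ∀ {c r} → BalancedMultipartiteTournament c r → Vertex c r → ℕ
inDeg {c} {r} T u = length (filter (λ v → arc T v u BP.≟ true) (vertices c r))

Regular : ∀ {c r} → BalancedMultipartiteTournament c r → Set
Regular T = ∀ u → inDeg T u ≡ outDeg T u

-- A partition into maximal tournaments: r vertex-disjoint tournaments of
-- order c covering all vertices. The k-th tournament has vertex set
-- { vtx k a | a : Fin c }. Its vertices lie in pairwise distinct partite
-- sets (so the induced subdigraph is a tournament), and (k , a) ↦ vtx k a
-- is a bijection onto the vertex set (disjointness + covering + order c).
record MaxTournamentPartition {c r : ℕ} (T : BalancedMultipartiteTournament c r) : Set where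
  field
    vtx : Fin r → Fin c → Vertex c r
    isTournament : ∀ k a b → a ≢ b → partOf (vtx k a) ≢ partOf (vtx k b)
    injective : ∀ k a l b → vtx k a ≡ vtx l b → (k , a) ≡ (l , b)
    covering : ∀ v → Σ (Fin r) λ k → Σ (Fin c) λ a → vtx k a ≡ v

open MaxTournamentPartition public

data Reach {c r : ℕ} {T : BalancedMultipartiteTournament c r}
           (P : MaxTournamentPartition T) (k : Fin r) : Fin c → Fin c → Set where
  here : ∀ a → Reach P k a a
  step : ∀ a b d → arc T (vtx P k a) (vtx P k b) ≡ true → Reach P k b d → Reach P k a d

StronglyConnectedPart : ∀ {c r} {T : BalancedMultipartiteTournament c r}
  → MaxTournamentPartition T → Fin r → Set
StronglyConnectedPart P k = ∀ a b → Reach P k a b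

HasStrongPartition : ∀ {c r} → BalancedMultipartiteTournament c r → Set
HasStrongPartition T = Σ (MaxTournamentPartition T) λ P → ∀ k → StronglyConnectedPart P k

-- c' has the property in the definition of ST(r): every regular r-balanced
-- c-partite tournament with c ≥ c' (and c ≥ 3) has a strong partition.
STProperty : ℕ → ℕ → Set
STProperty r c' = ∀ c → 3 ≤ c → c' ≤ c → (T : BalancedMultipartiteTournament c r)
  → Regular T → HasStrongPartition T

-- A partition of a 2-balanced multipartite tournament into two maximal
-- tournaments separates the two vertices of every partite set, so it is
-- determined by the tournament chosen for one vertex of each partite set.
-- For the regular 2-balanced 5-partite tournament T₀ each of the 2⁵ choices
-- leaves a vertex that, inside its own tournament, dominates or is dominated
-- by all the others, so that tournament is not strong.  Testing only for such
-- vertices loses nothing: strong components never have two vertices, so a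
-- non-strong tournament of order 5 has a one-vertex initial or terminal
-- component.
module Submission where

open import Defs
open import Data.Bool using (Bool; false; not)
import Data.Bool.Properties as Bool
open import Data.Fin using (Fin; zero; suc; opposite; punchIn)
open import Data.Fin.Patterns using (0F; 1F; 2F; 3F; 4F)
import Data.Fin.Properties as Fin
open import Data.List using (List; []; _∷_)
import Data.List.Membership.DecPropositional as Membership
open import Data.Nat using (ℕ; suc; _≤_; s≤s; z≤n)
import Data.Nat.Properties as ℕ
open import Data.Product using (∃; _,_; proj₁; proj₂)
open import Data.Product.Properties using (≡-dec)
open import Data.Sum using (_⊎_; inj₁; inj₂)
import Data.Sum as Sum
open import Data.Vec using (Vec; []; _∷_; lookup; tabulate)
open import Data.Vec.Properties using (lookup∘tabulate)
open import Function using (_∘_)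
open import Level using (Level)
open import Relation.Binary.PropositionalEquality using (_≡_; _≢_; _≗_; refl; sym; trans; cong; module ≡-Reasoning)
open import Relation.Nullary using (¬_; contradiction; Dec; yes; no; does; map′; _→-dec_; _⊎-dec_; ¬?; from-yes)
open import Relation.Unary using (Pred; Decidable)

private
  variable
    ℓ : Level
    c r n : ℕ

allVertices? : {P : Pred (Vertex c r) ℓ} → Decidable P → Dec (∀ v → P v)
allVertices? P? = map′ (λ h (i , j) → h i j) (λ h i j → h (i , j))
  (Fin.all? λ i → Fin.all? λ j → P? (i , j))

anyVertex? : {P : Pred (Vertex c r) ℓ} → Decidable P → Dec (∃ P)
anyVertex? P? = map′ (λ (i , j , p) → (i , j) , p) (λ ((i , j) , p) → i , j , p)
  (Fin.any? λ i → Fin.any? λ j → P? (i , j))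

allVectors? : {P : Pred (Vec (Fin r) n) ℓ} → Decidable P → Dec (∀ s → P s)
allVectors? {n = 0}     P? = map′ (λ { p [] → p }) (λ h → h []) (P? [])
allVectors? {n = suc n} P? = map′ (λ { h (x ∷ s) → h x s }) (λ h x s → h (x ∷ s))
  (Fin.all? λ x → allVectors? (P? ∘ (x ∷_)))

≢⇒≡opposite : (x y : Fin 2) → x ≢ y → y ≡ opposite x
≢⇒≡opposite zero       zero       x≢y = contradiction refl x≢y
≢⇒≡opposite zero       (suc zero) x≢y = refl
≢⇒≡opposite (suc zero) zero       x≢y = refl
≢⇒≡opposite (suc zero) (suc zero) x≢y = contradiction refl x≢y

module _ {T : BalancedMultipartiteTournament c r} (P : MaxTournamentPartition T) where

  tournamentOf : Vertex c r → Fin r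
  tournamentOf v = proj₁ (covering P v)

  tournamentOf-vtx : ∀ k a → tournamentOf (vtx P k a) ≡ k
  tournamentOf-vtx k a = cong proj₁ (injective P _ _ k a (proj₂ (proj₂ (covering P (vtx P k a)))))

  tournamentOf-injectiveOnParts : ∀ u v → partOf u ≡ partOf v → tournamentOf u ≡ tournamentOf v → u ≡ v
  tournamentOf-injectiveOnParts u v pu≡pv tu≡tv with covering P u | covering P v
  ... | k , a , refl | l , b , refl with refl ← tu≡tv with a Fin.≟ b
  ...   | yes refl = refl
  ...   | no a≢b   = contradiction pu≡pv (isTournament P k a b a≢b)

  IsSinkOfPart : Fin r → Fin c → Set
  IsSinkOfPart k a = ∀ b → arc T (vtx P k a) (vtx P k b) ≡ false

  IsSourceOfPart : Fin r → Fin c → Set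
  IsSourceOfPart k a = ∀ b → arc T (vtx P k b) (vtx P k a) ≡ false

  sink-reach : ∀ {k a b} → IsSinkOfPart k a → Reach P k a b → a ≡ b
  sink-reach sink (here _)            = refl
  sink-reach sink (step _ b _ a→b _) = contradiction (sink b) (Bool.not-¬ a→b)

  source-reach : ∀ {k a b} → IsSourceOfPart k a → Reach P k b a → b ≡ a
  source-reach source (here _)              = refl
  source-reach source (step b _ _ b→b′ b′⇝a) with refl ← source-reach source b′⇝a =
    contradiction (source b) (Bool.not-¬ b→b′)

module _ {T : BalancedMultipartiteTournament (suc (suc n)) r} (P : MaxTournamentPartition T) {k : Fin r} {a : Fin (suc (suc n))} where

  sink⇒¬strong : IsSinkOfPart P k a → ¬ StronglyConnectedPart P k
  sink⇒¬strong sink strong = Fin.punchInᵢ≢i a zero (sym (sink-reach P sink (strong a (punchIn a zero))))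

  source⇒¬strong : IsSourceOfPart P k a → ¬ StronglyConnectedPart P k
  source⇒¬strong source strong = Fin.punchInᵢ≢i a zero (source-reach P source (strong (punchIn a zero) a))

module _ (T : BalancedMultipartiteTournament c r) (χ : Vertex c r → Fin r) where

  IsSinkInClass : Vertex c r → Set
  IsSinkInClass v = ∀ w → χ w ≡ χ v → arc T v w ≡ false

  IsSourceInClass : Vertex c r → Set
  IsSourceInClass v = ∀ w → χ w ≡ χ v → arc T w v ≡ false

  HasClassSinkOrSource : Set
  HasClassSinkOrSource = ∃ λ v → IsSinkInClass v ⊎ IsSourceInClass v

  hasClassSinkOrSource? : Dec HasClassSinkOrSource
  hasClassSinkOrSource? = anyVertex? λ v → isSink? v ⊎-dec isSource? v
    where
    isSink? : Decidable IsSinkInClass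
    isSink? v = allVertices? λ w → (χ w Fin.≟ χ v) →-dec (arc T v w Bool.≟ false)
    isSource? : Decidable IsSourceInClass
    isSource? v = allVertices? λ w → (χ w Fin.≟ χ v) →-dec (arc T w v Bool.≟ false)

hasClassSinkOrSource-resp-≗ : ∀ (T : BalancedMultipartiteTournament c r) {χ ψ} → χ ≗ ψ →
  HasClassSinkOrSource T χ → HasClassSinkOrSource T ψ
hasClassSinkOrSource-resp-≗ T {χ} {ψ} χ≗ψ (v , sinkOrSource) = v , Sum.map restrict restrict sinkOrSource
  where
  restrict : ∀ {B : Vertex _ _ → Set} → (∀ w → χ w ≡ χ v → B w) → ∀ w → ψ w ≡ ψ v → B w
  restrict h w ψw≡ψv = h w (trans (χ≗ψ w) (trans ψw≡ψv (sym (χ≗ψ v))))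

module _ {T : BalancedMultipartiteTournament (suc (suc n)) r} (P : MaxTournamentPartition T) where

  classSinkOrSource⇒¬strong : HasClassSinkOrSource T (tournamentOf P) → ¬ (∀ k → StronglyConnectedPart P k)
  classSinkOrSource⇒¬strong (v , sinkOrSource) strong with covering P v
  ... | k , a , refl with sinkOrSource
  ...   | inj₁ sink   = sink⇒¬strong P (λ b → sink (vtx P k b) (tournamentOf-vtx P k b)) (strong k)
  ...   | inj₂ source = source⇒¬strong P (λ b → source (vtx P k b) (tournamentOf-vtx P k b)) (strong k)

colouring : Vec (Fin 2) c → Vertex c 2 → Fin 2
colouring s (i , zero)     = lookup s i
colouring s (i , suc zero) = opposite (lookup s i)

module _ {T : BalancedMultipartiteTournament c 2} (P : MaxTournamentPartition T) where

  choiceOf : Vec (Fin 2) c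
  choiceOf = tabulate λ i → tournamentOf P (i , zero)

  colouring-choiceOf : colouring choiceOf ≗ tournamentOf P
  colouring-choiceOf (i , zero)     = lookup∘tabulate _ i
  colouring-choiceOf (i , suc zero) = begin
    opposite (lookup choiceOf i)         ≡⟨ cong opposite (lookup∘tabulate _ i) ⟩
    opposite (tournamentOf P (i , zero)) ≡⟨ sym (≢⇒≡opposite _ _ separated) ⟩
    tournamentOf P (i , suc zero)        ∎
    where
    open ≡-Reasoning
    separated : tournamentOf P (i , zero) ≢ tournamentOf P (i , suc zero)
    separated = (λ ()) ∘ tournamentOf-injectiveOnParts P _ _ refl

classSinkOrSource⇒¬HasStrongPartition : (T : BalancedMultipartiteTournament (suc (suc n)) 2) →
  (∀ s → HasClassSinkOrSource T (colouring s)) → ¬ HasStrongPartition T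
classSinkOrSource⇒¬HasStrongPartition T every (P , strong) = classSinkOrSource⇒¬strong P
  (hasClassSinkOrSource-resp-≗ T (colouring-choiceOf P) (every (choiceOf P))) strong

outNeighbours₀ : Vertex 5 2 → List (Vertex 5 2)
outNeighbours₀ (0F , 0F) = (1F , 0F) ∷ (2F , 0F) ∷ (3F , 0F) ∷ (4F , 1F) ∷ []
outNeighbours₀ (0F , 1F) = (1F , 0F) ∷ (2F , 1F) ∷ (3F , 1F) ∷ (4F , 0F) ∷ []
outNeighbours₀ (1F , 0F) = (2F , 0F) ∷ (2F , 1F) ∷ (4F , 0F) ∷ (4F , 1F) ∷ []
outNeighbours₀ (1F , 1F) = (0F , 0F) ∷ (0F , 1F) ∷ (3F , 0F) ∷ (3F , 1F) ∷ []
outNeighbours₀ (2F , 0F) = (0F , 1F) ∷ (1F , 1F) ∷ (3F , 0F) ∷ (4F , 0F) ∷ []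
outNeighbours₀ (2F , 1F) = (0F , 0F) ∷ (1F , 1F) ∷ (3F , 1F) ∷ (4F , 1F) ∷ []
outNeighbours₀ (3F , 0F) = (0F , 1F) ∷ (1F , 0F) ∷ (2F , 1F) ∷ (4F , 1F) ∷ []
outNeighbours₀ (3F , 1F) = (0F , 0F) ∷ (1F , 0F) ∷ (2F , 0F) ∷ (4F , 0F) ∷ []
outNeighbours₀ (4F , 0F) = (0F , 0F) ∷ (1F , 1F) ∷ (2F , 1F) ∷ (3F , 0F) ∷ []
outNeighbours₀ (4F , 1F) = (0F , 1F) ∷ (1F , 1F) ∷ (2F , 0F) ∷ (3F , 1F) ∷ []

arc₀ : Vertex 5 2 → Vertex 5 2 → Bool
arc₀ u v = does (v ∈? outNeighbours₀ u)
  where open Membership (≡-dec Fin._≟_ Fin._≟_)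

T₀ : BalancedMultipartiteTournament 5 2
T₀ = record
  { arc         = arc₀
  ; noArcInPart = from-yes (allVertices? λ u → allVertices? λ v →
                    (partOf u Fin.≟ partOf v) →-dec (arc₀ u v Bool.≟ false))
  ; orient      = from-yes (allVertices? λ u → allVertices? λ v →
                    ¬? (partOf u Fin.≟ partOf v) →-dec (arc₀ u v Bool.≟ not (arc₀ v u)))
  }

T₀-regular : Regular T₀
T₀-regular = from-yes (allVertices? λ u → inDeg T₀ u ℕ.≟ outDeg T₀ u)

T₀-classSinkOrSource : ∀ s → HasClassSinkOrSource T₀ (colouring s)
T₀-classSinkOrSource = from-yes (allVectors? λ s → hasClassSinkOrSource? T₀ (colouring s))

lemma3p4 : ∀ c' → STProperty 2 c' → 6 ≤ c'
lemma3p4 c' st = ℕ.≰⇒> λ c'≤5 →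
  classSinkOrSource⇒¬HasStrongPartition T₀ T₀-classSinkOrSource
    (st 5 (s≤s (s≤s (s≤s z≤n))) c'≤5 T₀ T₀-regular)
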